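{- Let $k>r\ge3$ and let $G$ be an $r$-uniform hypergraph on $k$ vertices with at least one edge, not isomorphic to $K^{(r)}_k$ and not isomorphic to $S^{(r)}_k$. Then there exists a subgraph $G'$ of $G$ with \[ \frac{|E(G')|}{\max(2,\Delta(G'))}>\frac{|E(G)|}{\binom{k-1}{r-1}}. \]
   Context: $K^{(r)}_k$ is the complete $r$-graph on $k$ vertices; $S^{(r)}_k$ is the $k$-vertex $r$-graph whose edges are all $r$-subsets containing a fixed vertex. $\Delta(\cdot)$ denotes maximum degree. -}

module Defs where

open import Data.Nat using (ℕ; zero; suc; _⊔_; _≡ᵇ_)
open import Data.Bool using (Bool; true; false; T; _∧_)
open import Data.Fin using (Fin)
open import Data.Fin.Subset using (Subset; ∣_∣)
open import Data.Fin.Permutation using (Permutation′; _⟨$⟩ˡ_)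
open import Data.Vec using (Vec; []; _∷_; lookup; tabulate)
open import Data.List using (List; [_]; _++_; map; filterᵇ; length; foldr; allFin)
open import Data.Product using (Σ)
open import Relation.Binary.PropositionalEquality using (_≡_)

allSubsets : (n : ℕ) → List (Subset n)
allSubsets zero    = [ [] ]
allSubsets (suc n) = map (true ∷_) (allSubsets n) ++ map (false ∷_) (allSubsets n)

record Hypergraph (k r : ℕ) : Set where
  field
    isEdge  : Subset k → Bool
    uniform : ∀ s → T (isEdge s) → ∣ s ∣ ≡ r
open Hypergraph public

numEdges : ∀ {k r} → Hypergraph k r → ℕ
numEdges {k} G = length (filterᵇ (isEdge G) (allSubsets k))

degree : ∀ {k r} → Hypergraph k r → Fin k → ℕ
degree {k} G v = length (filterᵇ (λ s → isEdge G s ∧ lookup s v) (allSubsets k))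

-- Maximum degree Δ(G) (0 if k = 0).
maxDegree : ∀ {k r} → Hypergraph k r → ℕ
maxDegree {k} G = foldr _⊔_ 0 (map (degree G) (allFin k))

-- G' is a subgraph of G: every edge of G' is an edge of G
-- (same vertex set; isolated vertices do not affect |E| or Δ).
_⊆G_ : ∀ {k r} → Hypergraph k r → Hypergraph k r → Set
_⊆G_ {k} H G = ∀ (s : Subset k) → T (isEdge H s) → T (isEdge G s)

image : ∀ {k} → Permutation′ k → Subset k → Subset k
image π s = tabulate (λ j → lookup s (π ⟨$⟩ˡ j))

_≅_ : ∀ {k r} → Hypergraph k r → Hypergraph k r → Set
_≅_ {k} G H = Σ (Permutation′ k) (λ π → ∀ (s : Subset k) → isEdge G s ≡ isEdge H (image π s))

private
  ≡ᵇ-sound : ∀ m n → T (m ≡ᵇ n) → m ≡ n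
  ≡ᵇ-sound zero zero _ = Relation.Binary.PropositionalEquality.refl
  ≡ᵇ-sound (suc m) (suc n) p = Relation.Binary.PropositionalEquality.cong suc (≡ᵇ-sound m n p)
  ≡ᵇ-sound zero (suc n) ()
  ≡ᵇ-sound (suc m) zero ()

  ∧-left : ∀ a b → T (a ∧ b) → T a
  ∧-left true b _ = Data.Unit.tt
    where import Data.Unit
  ∧-left false b ()

complete : (k r : ℕ) → Hypergraph k r
complete k r = record { isEdge = λ s → ∣ s ∣ ≡ᵇ r ; uniform = λ s p → ≡ᵇ-sound ∣ s ∣ r p }

star : (k r : ℕ) → Fin k → Hypergraph k r
star k r v = record { isEdge = λ s → (∣ s ∣ ≡ᵇ r) ∧ lookup s v
                    ; uniform = λ s p → ≡ᵇ-sound ∣ s ∣ r (∧-left _ _ p) }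

-- Write k = n+1, r = r'+1 and Cn = C(n, r'), the largest possible degree.  Let W
-- be the set of saturated vertices (degree Cn); every r-set meeting W is an edge.
-- Cover W by t ≤ ⌈|W|/r⌉ r-sets meeting W and delete them: G' loses at most t
-- edges and every degree of G' is below Cn, so it suffices that t · Cn < |E(G)|.
-- This holds when |W| = 0 (t = 0), when |W| = 1 (t ≤ 1, and G is not the star
-- at the saturated vertex, so |E(G)| > Cn), and when |W| ≥ 2: since G is not
-- complete, a non-edge lies outside W, and double counting degrees, with the
-- vertices outside W having degree at least Cn - C(n-|W|, r'), gives it.
module Submission where

open import Defs
open import Data.Nat using (ℕ; _<_; _≤_; _*_; _⊔_; _∸_)
open import Data.Nat.Combinatorics using (_C_)
open import Data.Fin using (Fin)
open import Data.Product using (Σ; _×_)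
open import Relation.Nullary using (¬_)

open import Data.Nat using (zero; suc; _+_; _≡ᵇ_; z≤n; s≤s)
open import Data.Nat.Properties
open import Data.Nat.Combinatorics using (nCk+nC[k+1]≡[n+1]C[k+1]; nC1≡n; nCk≡nC[n∸k])
open import Data.Nat.Tactic.RingSolver using (solve-∀)
open import Data.Bool using (Bool; true; false; T; _∧_; _∨_; not; _xor_; if_then_else_)
open import Data.Bool.Properties using (T-∧; T-∨; T-≡; T-not-≡; ∧-zeroʳ; ∧-identityʳ; ∧-assoc; ∧-comm)
open import Data.Unit using (tt)
open import Data.Empty using (⊥-elim)
open import Data.Sum using (_⊎_; inj₁; inj₂) renaming ([_,_]′ to either)
open import Data.Product using (_,_; proj₁; proj₂)
open import Data.Fin using (zero; suc)
open import Data.Fin.Subset using (Subset; ∣_∣) renaming (⊥ to ∅; ⊤ to full)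
open import Data.Fin.Subset.Properties using (∣p∣≤n; ∣⊥∣≡0; ∣⊤∣≡n; anySubset?)
open import Data.Fin.Permutation using (id)
open import Data.Vec using ([]; _∷_; lookup; tabulate)
open import Data.Vec.Properties using (lookup∘tabulate; tabulate∘lookup)
open import Data.List using (List; []; _∷_; _++_; map; filterᵇ; length; foldr; allFin)
open import Data.List.Membership.Propositional using (_∈_)
open import Data.List.Membership.Propositional.Properties using (∈-++⁺ˡ; ∈-++⁺ʳ; ∈-map⁺)
open import Data.List.Relation.Unary.All using (All; []; _∷_) renaming (map to All-map)
open import Data.List.Relation.Unary.Any using (Any; here; there)
open import Function.Bundles using (Equivalence)
open import Algebra.Properties.CommutativeMonoid.Sum +-0-commutativeMonoid using (sum; ∑-distrib-+; sum-cong-≗; sum-replicate-zero)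
open import Relation.Nullary using (yes; no)
open import Relation.Nullary.Decidable using (T?)
open import Relation.Binary.PropositionalEquality

∧-introᵀ : ∀ {a b} → T a → T b → T (a ∧ b)
∧-introᵀ p q = Equivalence.from T-∧ (p , q)

∧-elimˡᵀ : ∀ {a b} → T (a ∧ b) → T a
∧-elimˡᵀ p = proj₁ (Equivalence.to T-∧ p)

∧-elimʳᵀ : ∀ {a b} → T (a ∧ b) → T b
∧-elimʳᵀ p = proj₂ (Equivalence.to T-∧ p)

¬T⇒false : ∀ {b} → ¬ T b → b ≡ false
¬T⇒false {true}  ¬b = ⊥-elim (¬b tt)
¬T⇒false {false} _  = refl

count : {A : Set} → (A → Bool) → List A → ℕ
count p xs = length (filterᵇ p xs)

indicator : Bool → ℕ
indicator b = if b then 1 else 0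

count-∷ : {A : Set} (p : A → Bool) (x : A) (xs : List A) →
  count p (x ∷ xs) ≡ indicator (p x) + count p xs
count-∷ p x xs with p x
... | true  = refl
... | false = refl

count-++ : {A : Set} (p : A → Bool) (xs ys : List A) →
  count p (xs ++ ys) ≡ count p xs + count p ys
count-++ p []       ys = refl
count-++ p (x ∷ xs) ys = begin
  count p (x ∷ xs ++ ys)                   ≡⟨ count-∷ p x (xs ++ ys) ⟩
  indicator (p x) + count p (xs ++ ys)     ≡⟨ cong (indicator (p x) +_) (count-++ p xs ys) ⟩
  indicator (p x) + (count p xs + count p ys) ≡⟨ +-assoc (indicator (p x)) _ _ ⟨
  (indicator (p x) + count p xs) + count p ys ≡⟨ cong (_+ count p ys) (count-∷ p x xs) ⟨
  count p (x ∷ xs) + count p ys            ∎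
  where open ≡-Reasoning

count-map : {A B : Set} (p : B → Bool) (f : A → B) (xs : List A) →
  count p (map f xs) ≡ count (λ x → p (f x)) xs
count-map p f []       = refl
count-map p f (x ∷ xs) with p (f x)
... | true  = cong suc (count-map p f xs)
... | false = count-map p f xs

count-ext : {A : Set} {p q : A → Bool} → (∀ x → p x ≡ q x) → (xs : List A) →
  count p xs ≡ count q xs
count-ext p≗q []       = refl
count-ext {p = p} {q} p≗q (x ∷ xs) = begin
  count p (x ∷ xs)                 ≡⟨ count-∷ p x xs ⟩
  indicator (p x) + count p xs     ≡⟨ cong₂ (λ b c → indicator b + c) (p≗q x) (count-ext p≗q xs) ⟩
  indicator (q x) + count q xs     ≡⟨ count-∷ q x xs ⟨
  count q (x ∷ xs)                 ∎
  where open ≡-Reasoning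

count-split : {A : Set} (p q : A → Bool) (xs : List A) →
  count p xs ≡ count (λ x → p x ∧ q x) xs + count (λ x → p x ∧ not (q x)) xs
count-split p q []       = refl
count-split p q (x ∷ xs) with p x | q x
... | false | _     = count-split p q xs
... | true  | true  = cong suc (count-split p q xs)
... | true  | false = trans (cong suc (count-split p q xs)) (sym (+-suc _ _))

count-mono : {A : Set} {p q : A → Bool} → (∀ x → T (p x) → T (q x)) → (xs : List A) →
  count p xs ≤ count q xs
count-mono p⇒q [] = z≤n
count-mono {p = p} {q} p⇒q (x ∷ xs) with p x | q x | p⇒q x
... | true  | true  | _   = s≤s (count-mono p⇒q xs)
... | true  | false | imp = ⊥-elim (imp tt)
... | false | true  | _   = m≤n⇒m≤1+n (count-mono p⇒q xs)
... | false | false | _   = count-mono p⇒q xs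

count-∨ : {A : Set} (p q : A → Bool) (xs : List A) →
  count (λ x → p x ∨ q x) xs ≤ count p xs + count q xs
count-∨ p q []       = z≤n
count-∨ p q (x ∷ xs) with p x | q x
... | true  | true  = s≤s (≤-trans (count-∨ p q xs) (+-monoʳ-≤ (count p xs) (n≤1+n _)))
... | true  | false = s≤s (count-∨ p q xs)
... | false | true  = ≤-trans (s≤s (count-∨ p q xs)) (≤-reflexive (sym (+-suc _ _)))
... | false | false = count-∨ p q xs

count-pos : {A : Set} (p : A → Bool) {x : A} {xs : List A} → x ∈ xs → T (p x) → 1 ≤ count p xs
count-pos p {xs = y ∷ xs} (here refl) px with p y
... | true = s≤s z≤n
count-pos p {xs = y ∷ xs} (there x∈xs) px with p y
... | true  = s≤s z≤n
... | false = count-pos p x∈xs px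

count-none : {A : Set} {p : A → Bool} → (∀ x → p x ≡ false) → (xs : List A) → count p xs ≡ 0
count-none p≡false []       = refl
count-none p≡false (x ∷ xs) rewrite p≡false x = count-none p≡false xs

∈-allSubsets : ∀ {k} (s : Subset k) → s ∈ allSubsets k
∈-allSubsets []                = here refl
∈-allSubsets {suc k} (true ∷ s)  = ∈-++⁺ˡ (∈-map⁺ (true ∷_) (∈-allSubsets s))
∈-allSubsets {suc k} (false ∷ s) = ∈-++⁺ʳ (map (true ∷_) (allSubsets k)) (∈-map⁺ (false ∷_) (∈-allSubsets s))

count-allSubsets-suc : ∀ {k} (p : Subset (suc k) → Bool) →
  count p (allSubsets (suc k)) ≡
  count (λ s → p (true ∷ s)) (allSubsets k) + count (λ s → p (false ∷ s)) (allSubsets k)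
count-allSubsets-suc {k} p = begin
  count p (map (true ∷_) (allSubsets k) ++ map (false ∷_) (allSubsets k))
    ≡⟨ count-++ p (map (true ∷_) (allSubsets k)) (map (false ∷_) (allSubsets k)) ⟩
  count p (map (true ∷_) (allSubsets k)) + count p (map (false ∷_) (allSubsets k))
    ≡⟨ cong₂ _+_ (count-map p (true ∷_) (allSubsets k)) (count-map p (false ∷_) (allSubsets k)) ⟩
  count (λ s → p (true ∷ s)) (allSubsets k) + count (λ s → p (false ∷ s)) (allSubsets k) ∎
  where open ≡-Reasoning

disjoint : ∀ {k} → Subset k → Subset k → Bool
disjoint []      []      = true
disjoint (x ∷ s) (y ∷ t) = not (x ∧ y) ∧ disjoint s t

Meets : ∀ {k} → Subset k → Subset k → Set
Meets ρ X = T (not (disjoint ρ X))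

meets-witness : ∀ {k} (s t : Subset k) → Meets s t → Σ (Fin k) (λ x → T (lookup s x) × T (lookup t x))
meets-witness []          []          ()
meets-witness (true ∷ s)  (true ∷ t)  _ = zero , tt , tt
meets-witness (true ∷ s)  (false ∷ t) m with meets-witness s t m
... | x , sx , tx = suc x , sx , tx
meets-witness (false ∷ s) (y ∷ t)     m with meets-witness s t m
... | x , sx , tx = suc x , sx , tx

witness-meets : ∀ {k} (s t : Subset k) (x : Fin k) → T (lookup s x) → T (lookup t x) → Meets s t
witness-meets (true ∷ s) (true ∷ t) zero    _  _  = tt
witness-meets (a ∷ s)    (b ∷ t)    (suc x) sx tx with a ∧ b
... | true  = tt
... | false = witness-meets s t x sx tx

disjoint-∅ : ∀ {k} (s : Subset k) → disjoint s ∅ ≡ true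
disjoint-∅ []      = refl
disjoint-∅ (true ∷ s)  = disjoint-∅ s
disjoint-∅ (false ∷ s) = disjoint-∅ s

lookup-∅ : ∀ {k} (u : Fin k) → lookup ∅ u ≡ false
lookup-∅ zero    = refl
lookup-∅ (suc u) = lookup-∅ u

disjoint-size : ∀ {k} (s t : Subset k) → T (disjoint s t) → ∣ s ∣ + ∣ t ∣ ≤ k
disjoint-size []          []          _ = z≤n
disjoint-size (true ∷ s)  (false ∷ t) d = s≤s (disjoint-size s t d)
disjoint-size (false ∷ s) (true ∷ t)  d rewrite +-suc ∣ s ∣ ∣ t ∣ = s≤s (disjoint-size s t d)
disjoint-size (false ∷ s) (false ∷ t) d = m≤n⇒m≤1+n (disjoint-size s t d)

member⇒nonempty : ∀ {k} (s : Subset k) (x : Fin k) → T (lookup s x) → 1 ≤ ∣ s ∣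
member⇒nonempty (true ∷ s)  _       _  = s≤s z≤n
member⇒nonempty (false ∷ s) (suc x) sx = member⇒nonempty s x sx

nonempty⇒member : ∀ {k} (s : Subset k) → 1 ≤ ∣ s ∣ → Σ (Fin k) (λ x → T (lookup s x))
nonempty⇒member (true ∷ s)  _   = zero , tt
nonempty⇒member (false ∷ s) pos with nonempty⇒member s pos
... | x , sx = suc x , sx

outside⇒size≤ : ∀ {n} (B : Subset (suc n)) (u : Fin (suc n)) → lookup B u ≡ false → ∣ B ∣ ≤ n
outside⇒size≤ (false ∷ B) zero    _ = ∣p∣≤n B
outside⇒size≤ {suc n} (true ∷ B)  (suc u) u∉B = s≤s (outside⇒size≤ B u u∉B)
outside⇒size≤ {suc n} (false ∷ B) (suc u) u∉B = m≤n⇒m≤1+n (outside⇒size≤ B u u∉B)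

count-disjoint : ∀ k j (B : Subset k) →
  count (λ s → (∣ s ∣ ≡ᵇ j) ∧ disjoint s B) (allSubsets k) ≡ (k ∸ ∣ B ∣) C j
count-disjoint zero    zero    [] = refl
count-disjoint zero    (suc j) [] = refl
count-disjoint (suc k) j (true ∷ B)
  rewrite count-allSubsets-suc (λ s → (∣ s ∣ ≡ᵇ j) ∧ disjoint s (true ∷ B))
        | count-none {p = λ s → (∣ true ∷ s ∣ ≡ᵇ j) ∧ false} (λ s → ∧-zeroʳ _) (allSubsets k)
  = count-disjoint k j B
count-disjoint (suc k) zero (false ∷ B)
  rewrite count-allSubsets-suc (λ s → (∣ s ∣ ≡ᵇ zero) ∧ disjoint s (false ∷ B))
        | count-none {p = λ _ → false} (λ _ → refl) (allSubsets k)
        | count-disjoint k zero B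
  = refl
count-disjoint (suc k) (suc j) (false ∷ B)
  rewrite count-allSubsets-suc (λ s → (∣ s ∣ ≡ᵇ suc j) ∧ disjoint s (false ∷ B))
        | count-disjoint k j B | count-disjoint k (suc j) B | +-∸-assoc 1 (∣p∣≤n B)
  = nCk+nC[k+1]≡[n+1]C[k+1] (k ∸ ∣ B ∣) j

empty-lacks : ∀ {k} (s : Subset k) (u : Fin k) → ((∣ s ∣ ≡ᵇ 0) ∧ lookup s u) ≡ false
empty-lacks (true ∷ s)  u       = refl
empty-lacks (false ∷ s) zero    = ∧-zeroʳ _
empty-lacks (false ∷ s) (suc u) = empty-lacks s u

count-through-disjoint : ∀ n j (u : Fin (suc n)) (B : Subset (suc n)) → lookup B u ≡ false →
  count (λ s → ((∣ s ∣ ≡ᵇ suc j) ∧ lookup s u) ∧ disjoint s B) (allSubsets (suc n)) ≡ (n ∸ ∣ B ∣) C j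
count-through-disjoint n j zero (false ∷ B) _
  rewrite count-allSubsets-suc (λ s → ((∣ s ∣ ≡ᵇ suc j) ∧ lookup s zero) ∧ disjoint s (false ∷ B))
        | count-none {p = λ s → ((∣ s ∣ ≡ᵇ suc j) ∧ false) ∧ disjoint s B}
                     (λ s → cong (_∧ disjoint s B) (∧-zeroʳ _)) (allSubsets n)
        | count-ext {q = λ s → (∣ s ∣ ≡ᵇ j) ∧ disjoint s B}
                    (λ s → cong (_∧ disjoint s B) (∧-identityʳ _)) (allSubsets n)
        | count-disjoint n j B
  = +-identityʳ _
count-through-disjoint (suc n) j (suc u) (true ∷ B) u∉B
  rewrite count-allSubsets-suc (λ s → ((∣ s ∣ ≡ᵇ suc j) ∧ lookup s (suc u)) ∧ disjoint s (true ∷ B))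
        | count-none {p = λ s → ((∣ true ∷ s ∣ ≡ᵇ suc j) ∧ lookup s u) ∧ false}
                     (λ s → ∧-zeroʳ _) (allSubsets (suc n))
  = count-through-disjoint n j u B u∉B
count-through-disjoint (suc n) zero (suc u) (false ∷ B) u∉B
  rewrite count-allSubsets-suc (λ s → ((∣ s ∣ ≡ᵇ 1) ∧ lookup s (suc u)) ∧ disjoint s (false ∷ B))
        | count-none {p = λ s → ((∣ s ∣ ≡ᵇ 0) ∧ lookup s u) ∧ disjoint s B}
                     (λ s → cong (_∧ disjoint s B) (empty-lacks s u)) (allSubsets (suc n))
        | count-through-disjoint n zero u B u∉B
  = refl
count-through-disjoint (suc n) (suc j) (suc u) (false ∷ B) u∉B
  rewrite count-allSubsets-suc (λ s → ((∣ s ∣ ≡ᵇ suc (suc j)) ∧ lookup s (suc u)) ∧ disjoint s (false ∷ B))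
        | count-through-disjoint n j u B u∉B | count-through-disjoint n (suc j) u B u∉B
        | +-∸-assoc 1 (outside⇒size≤ B u u∉B)
  = nCk+nC[k+1]≡[n+1]C[k+1] (n ∸ ∣ B ∣) j

sameSubset : ∀ {k} → Subset k → Subset k → Bool
sameSubset []      []      = true
sameSubset (x ∷ s) (y ∷ t) = not (x xor y) ∧ sameSubset s t

sameSubset-refl : ∀ {k} (s : Subset k) → T (sameSubset s s)
sameSubset-refl []          = tt
sameSubset-refl (true ∷ s)  = sameSubset-refl s
sameSubset-refl (false ∷ s) = sameSubset-refl s

count-sameSubset : ∀ {k} (ρ : Subset k) → count (λ s → sameSubset s ρ) (allSubsets k) ≤ 1
count-sameSubset []                = ≤-refl
count-sameSubset {suc k} (true ∷ ρ)
  rewrite count-allSubsets-suc (λ s → sameSubset s (true ∷ ρ))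
        | count-none {p = λ _ → false} (λ _ → refl) (allSubsets k)
        | +-identityʳ (count (λ s → sameSubset s ρ) (allSubsets k))
  = count-sameSubset ρ
count-sameSubset {suc k} (false ∷ ρ)
  rewrite count-allSubsets-suc (λ s → sameSubset s (false ∷ ρ))
        | count-none {p = λ _ → false} (λ _ → refl) (allSubsets k)
  = count-sameSubset ρ

oneOf : ∀ {k} → List (Subset k) → Subset k → Bool
oneOf []      s = false
oneOf (ρ ∷ R) s = sameSubset s ρ ∨ oneOf R s

count-oneOf : ∀ {k} (R : List (Subset k)) → count (oneOf R) (allSubsets k) ≤ length R
count-oneOf {k} []      = ≤-reflexive (count-none (λ _ → refl) (allSubsets k))
count-oneOf {k} (ρ ∷ R) = ≤-trans (count-∨ (λ s → sameSubset s ρ) (oneOf R) (allSubsets k))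
                                  (+-mono-≤ (count-sameSubset ρ) (count-oneOf R))

pick : ∀ {k} {P Q : Subset k → Set} (R : List (Subset k)) → All P R → Any Q R →
  Σ (Subset k) λ ρ → P ρ × Q ρ × T (oneOf R ρ)
pick (ρ ∷ R) (pρ ∷ _)  (here qρ) = ρ , pρ , qρ , Equivalence.from T-∨ (inj₁ (sameSubset-refl ρ))
pick (ρ ∷ R) (_ ∷ all) (there a) with pick R all a
... | σ , pσ , qσ , σ∈R = σ , pσ , qσ , Equivalence.from T-∨ (inj₂ σ∈R)

sum-mono : ∀ {k} {f g : Fin k → ℕ} → (∀ u → f u ≤ g u) → sum f ≤ sum g
sum-mono {zero}  f≤g = z≤n
sum-mono {suc k} f≤g = +-mono-≤ (f≤g zero) (sum-mono (λ u → f≤g (suc u)))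

sum-size : ∀ {k} (s : Subset k) → sum (λ u → indicator (lookup s u)) ≡ ∣ s ∣
sum-size []          = refl
sum-size (true ∷ s)  = cong suc (sum-size s)
sum-size (false ∷ s) = sum-size s

sum-two-valued : ∀ {k} (W : Subset k) (a b : ℕ) →
  sum (λ u → if lookup W u then a else b) ≡ ∣ W ∣ * a + (k ∸ ∣ W ∣) * b
sum-two-valued []           a b = refl
sum-two-valued (true ∷ W)   a b = trans (cong (a +_) (sum-two-valued W a b)) (sym (+-assoc a _ _))
sum-two-valued {suc k} (false ∷ W) a b
  rewrite sum-two-valued W a b | +-∸-assoc 1 (∣p∣≤n W) = x+[y+z]≡y+[x+z] b (∣ W ∣ * a) ((k ∸ ∣ W ∣) * b)
  where
  x+[y+z]≡y+[x+z] : ∀ x y z → x + (y + z) ≡ y + (x + z)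
  x+[y+z]≡y+[x+z] = solve-∀

handshake : ∀ {k} (E : Subset k → Bool) r → (∀ s → T (E s) → ∣ s ∣ ≡ r) → (xs : List (Subset k)) →
  sum (λ u → count (λ s → E s ∧ lookup s u) xs) ≡ r * count E xs
handshake {k} E r uni []       = trans (sum-replicate-zero k) (sym (*-zeroʳ r))
handshake {k} E r uni (x ∷ xs) = begin
  sum (λ u → count (λ s → E s ∧ lookup s u) (x ∷ xs))
    ≡⟨ sum-cong-≗ (λ u → count-∷ (λ s → E s ∧ lookup s u) x xs) ⟩
  sum (λ u → indicator (E x ∧ lookup x u) + count (λ s → E s ∧ lookup s u) xs)
    ≡⟨ ∑-distrib-+ (λ u → indicator (E x ∧ lookup x u)) _ ⟩
  sum (λ u → indicator (E x ∧ lookup x u)) + sum (λ u → count (λ s → E s ∧ lookup s u) xs)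
    ≡⟨ cong₂ _+_ (head-term (E x) refl) (handshake E r uni xs) ⟩
  r * indicator (E x) + r * count E xs
    ≡⟨ *-distribˡ-+ r (indicator (E x)) (count E xs) ⟨
  r * (indicator (E x) + count E xs)
    ≡⟨ cong (r *_) (count-∷ E x xs) ⟨
  r * count E (x ∷ xs) ∎
  where
  open ≡-Reasoning
  head-term : ∀ b → E x ≡ b → sum (λ u → indicator (b ∧ lookup x u)) ≡ r * indicator b
  head-term true  Ex = trans (sum-size x) (trans (uni x (Equivalence.from T-≡ Ex)) (sym (*-identityʳ r)))
  head-term false _  = trans (sum-replicate-zero k) (sym (*-zeroʳ r))

pascal : ∀ n k → suc n C suc k ≡ n C k + n C suc k
pascal n k = sym (nCk+nC[k+1]≡[n+1]C[k+1] n k)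

C-above : ∀ n k → n < k → n C k ≡ 0
C-above zero    (suc k) _         = refl
C-above (suc n) (suc k) (s≤s n<k)
  rewrite pascal n k | C-above n k n<k | C-above n (suc k) (m≤n⇒m≤1+n n<k) = refl

absorption : ∀ n j → suc j * (suc n C suc j) ≡ suc n * (n C j)
absorption zero zero          = refl
absorption zero (suc j)
  rewrite C-above 1 (suc (suc j)) (s≤s (s≤s z≤n)) | C-above 0 (suc j) (s≤s z≤n) | *-zeroʳ j = refl
absorption (suc n) zero
  rewrite pascal (suc n) 0 | nC1≡n (suc n) = trans (+-identityʳ (suc (suc n))) (sym (*-identityʳ (suc (suc n))))
absorption (suc n) (suc j) = begin
  suc (suc j) * (suc (suc n) C suc (suc j))  ≡⟨ cong (suc (suc j) *_) (pascal (suc n) (suc j)) ⟩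
  suc (suc j) * (A + B)                      ≡⟨ *-distribˡ-+ (suc (suc j)) A B ⟩
  (A + suc j * A) + suc (suc j) * B          ≡⟨ cong₂ (λ x y → (A + x) + y) (absorption n j) (absorption n (suc j)) ⟩
  (A + suc n * a) + suc n * b                ≡⟨ +-assoc A _ _ ⟩
  A + (suc n * a + suc n * b)                ≡⟨ cong (A +_) (*-distribˡ-+ (suc n) a b) ⟨
  A + suc n * (a + b)                        ≡⟨ cong (λ z → A + suc n * z) (pascal n j) ⟨
  suc (suc n) * A                            ∎
  where
  open ≡-Reasoning
  A = suc n C suc j
  B = suc n C suc (suc j)
  a = n C j
  b = n C suc j

C-step : ∀ x j → x C j ≤ suc x C j
C-step x zero    = ≤-refl
C-step x (suc j) rewrite pascal x j = m≤n+m (x C suc j) (x C j)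

C-monoˡ : ∀ j {x y} → x ≤ y → x C j ≤ y C j
C-monoˡ j {y = zero}  z≤n   = ≤-refl
C-monoˡ j {y = suc y} x≤1+y with m≤n⇒m<n∨m≡n x≤1+y
... | inj₁ x<1+y = ≤-trans (C-monoˡ j (≤-pred x<1+y)) (C-step y j)
... | inj₂ refl  = ≤-refl

C-pos : ∀ x j → j ≤ x → 1 ≤ x C j
C-pos x       zero    _         = ≤-refl
C-pos (suc x) (suc j) (s≤s j≤x) rewrite pascal x j = ≤-trans (C-pos x j j≤x) (m≤m+n (x C j) _)

-- C(n, r) ≥ 3 whenever 2 ≤ r < n, since C(r + 1, r) = r + 1.
C≥3 : ∀ n r → 2 ≤ r → r < n → 3 ≤ n C r
C≥3 n r 2≤r r<n = begin
  3                  ≤⟨ s≤s 2≤r ⟩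
  suc r              ≡⟨ nC1≡n (suc r) ⟨
  suc r C 1          ≡⟨ cong (suc r C_) (m+n∸n≡m 1 r) ⟨
  suc r C (suc r ∸ r) ≡⟨ nCk≡nC[n∸k] (n≤1+n r) ⟨
  suc r C r          ≤⟨ C-monoˡ r r<n ⟩
  n C r              ∎
  where open ≤-Reasoning

-- The binomial inequality behind the case of at least two saturated vertices:
-- for 1 ≤ r ≤ a and a + 2 ≤ n,  r C(n,r) + (a+1) C(a,r) < (a+1) C(n,r).
-- With p = a + 1 - r ≥ 1 and X = C(a+1, r), absorption and Pascal give
-- p X = (a+1) C(a,r), and X < C(n, r).
binomial-key : ∀ a r n → 1 ≤ r → r ≤ a → a + 2 ≤ n →
  r * (n C r) + suc a * (a C r) < suc a * (n C r)
binomial-key a (suc j) n _ r≤a a+2≤n with m≤n⇒∃[o]m+o≡n (m≤n⇒m≤1+n r≤a)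
... | zero  , r+0≡1+a = ⊥-elim (1+n≰n (subst (_≤ a) (trans (sym (+-identityʳ (suc j))) r+0≡1+a) r≤a))
... | suc p , r+p≡1+a = begin-strict
  r * Cn + suc a * D         ≡⟨ cong (r * Cn +_) pX≡[1+a]D ⟨
  r * Cn + suc p * X         <⟨ +-monoʳ-< (r * Cn) (*-monoʳ-< (suc p) X<Cn) ⟩
  r * Cn + suc p * Cn        ≡⟨ *-distribʳ-+ Cn r (suc p) ⟨
  (r + suc p) * Cn           ≡⟨ cong (_* Cn) r+p≡1+a ⟩
  suc a * Cn                 ∎
  where
  open ≤-Reasoning
  r = suc j
  X = suc a C r
  D = a C r
  Cn = n C r
  [1+a]X≡rX+[1+a]D : suc a * X ≡ r * X + suc a * D
  [1+a]X≡rX+[1+a]D = begin-equality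
    suc a * X                           ≡⟨ cong (suc a *_) (pascal a j) ⟩
    suc a * (a C j + D)                 ≡⟨ *-distribˡ-+ (suc a) (a C j) D ⟩
    suc a * (a C j) + suc a * D         ≡⟨ cong (_+ suc a * D) (absorption a j) ⟨
    r * X + suc a * D                   ∎
  pX≡[1+a]D : suc p * X ≡ suc a * D
  pX≡[1+a]D = +-cancelˡ-≡ (r * X) _ _ (begin-equality
    r * X + suc p * X                   ≡⟨ *-distribʳ-+ X r (suc p) ⟨
    (r + suc p) * X                     ≡⟨ cong (_* X) r+p≡1+a ⟩
    suc a * X                           ≡⟨ [1+a]X≡rX+[1+a]D ⟩
    r * X + suc a * D                   ∎)
  X<Cn : X < Cn
  X<Cn = begin-strict
    X                      <⟨ m<n+m X (C-pos (suc a) j (m≤n⇒m≤1+n (≤-trans (n≤1+n j) r≤a))) ⟩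
    suc a C j + X          ≡⟨ pascal (suc a) j ⟨
    suc (suc a) C r        ≤⟨ C-monoˡ r (subst (_≤ n) (+-comm a 2) a+2≤n) ⟩
    Cn                     ∎

_⊆ₛ_ : ∀ {k} → Subset k → Subset k → Set
Y ⊆ₛ X = ∀ u → T (lookup Y u) → T (lookup X u)

lookup-full : ∀ {k} (u : Fin k) → lookup full u ≡ true
lookup-full zero    = refl
lookup-full (suc u) = lookup-full u

record Split {k} (j : ℕ) (X : Subset k) : Set where
  field
    part rest   : Subset k
    part⊆X      : part ⊆ₛ X
    rest⊆X      : rest ⊆ₛ X
    union       : ∀ u → T (lookup X u) → T (lookup part u) ⊎ T (lookup rest u)
    size-part   : ∣ part ∣ ≡ j
    size-sum    : ∣ part ∣ + ∣ rest ∣ ≡ ∣ X ∣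

split : ∀ {k} j (X : Subset k) → j ≤ ∣ X ∣ → Split j X
split {k} zero X _ = record
  { part = ∅ ; rest = X ; part⊆X = λ u ∅u → ⊥-elim (subst T (lookup-∅ u) ∅u)
  ; rest⊆X = λ _ Xu → Xu ; union = λ _ Xu → inj₂ Xu
  ; size-part = ∣⊥∣≡0 k ; size-sum = cong (_+ ∣ X ∣) (∣⊥∣≡0 k) }
split (suc j) (true ∷ X) (s≤s j≤∣X∣) = record
  { part = true ∷ part ; rest = false ∷ rest
  ; part⊆X = λ { zero _ → tt ; (suc u) Yu → part⊆X u Yu }
  ; rest⊆X = λ { (suc u) Zu → rest⊆X u Zu }
  ; union = λ { zero _ → inj₁ tt ; (suc u) Xu → union u Xu }
  ; size-part = cong suc size-part ; size-sum = cong suc size-sum }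
  where open Split (split j X j≤∣X∣)
split (suc j) (false ∷ X) j≤∣X∣ = record
  { part = false ∷ part ; rest = false ∷ rest
  ; part⊆X = λ { (suc u) Yu → part⊆X u Yu }
  ; rest⊆X = λ { (suc u) Zu → rest⊆X u Zu }
  ; union = λ { (suc u) Xu → union u Xu }
  ; size-part = size-part ; size-sum = size-sum }
  where open Split (split (suc j) X j≤∣X∣)

extend : ∀ {k} j (X : Subset k) → ∣ X ∣ ≤ j → j ≤ k → Σ (Subset k) λ Y → X ⊆ₛ Y × ∣ Y ∣ ≡ j
extend {zero} zero [] _ _ = [] , (λ _ Xu → Xu) , refl
extend {suc k} (suc j) (true ∷ X) (s≤s ∣X∣≤j) (s≤s j≤k) with extend j X ∣X∣≤j j≤k
... | Y , X⊆Y , ∣Y∣≡j = true ∷ Y , (λ { zero _ → tt ; (suc u) Xu → X⊆Y u Xu }) , cong suc ∣Y∣≡j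
extend {suc k} j (false ∷ X) ∣X∣≤j j≤1+k with j ≤? k
... | yes j≤k with extend j X ∣X∣≤j j≤k
...   | Y , X⊆Y , ∣Y∣≡j = false ∷ Y , (λ { (suc u) Xu → X⊆Y u Xu }) , ∣Y∣≡j
extend {suc k} j (false ∷ X) ∣X∣≤j j≤1+k | no j≰k =
  full , (λ u _ → Equivalence.from T-≡ (lookup-full u)) , trans (∣⊤∣≡n (suc k)) (≤-antisym (≰⇒> j≰k) j≤1+k)

-- A cover of X by (r'+1)-sets each meeting X, using at most ⌈|X| / (r'+1)⌉ sets.
record Cover {k} (r' : ℕ) (X : Subset k) : Set where
  field
    sets   : List (Subset k)
    valid  : All (λ ρ → ∣ ρ ∣ ≡ suc r' × Meets ρ X) sets
    covers : ∀ u → T (lookup X u) → Any (λ ρ → T (lookup ρ u)) sets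
    few    : length sets * suc r' ≤ ∣ X ∣ + r'

cover-small : ∀ {k} r' (X : Subset k) → ∣ X ∣ ≤ suc r' → suc r' ≤ k → Cover r' X
cover-small r' X ∣X∣≤r suc-r'≤k with ∣ X ∣ in ∣X∣≡
... | zero = record { sets = [] ; valid = [] ; few = z≤n ; covers = λ u Xu →
        ⊥-elim (1+n≰n (subst (1 ≤_) ∣X∣≡ (member⇒nonempty X u Xu))) }
... | suc m with extend (suc r') X (subst (_≤ suc r') (sym ∣X∣≡) ∣X∣≤r) suc-r'≤k | nonempty⇒member X (subst (1 ≤_) (sym ∣X∣≡) (s≤s z≤n))
...   | Y , X⊆Y , ∣Y∣≡r | u , Xu = record
  { sets = Y ∷ [] ; valid = (∣Y∣≡r , witness-meets Y X u (X⊆Y u Xu) Xu) ∷ []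
  ; covers = λ v Xv → here (X⊆Y v Xv)
  ; few = subst (λ z → 1 * suc r' ≤ z + r') (sym ∣X∣≡)
                (subst (_≤ suc m + r') (sym (*-identityˡ (suc r'))) (s≤s (m≤n+m r' m))) }

cover-step : ∀ {k} r' (X : Subset k) (S : Split (suc r') X) → Cover r' (Split.rest S) → Cover r' X
cover-step r' X S C = record
  { sets = part ∷ sets
  ; valid = (size-part , part-meets) ∷ All-map (λ {ρ} → meets-X {ρ}) valid
  ; covers = λ u Xu → either here (λ rest-u → there (covers u rest-u)) (union u Xu)
  ; few = begin
      suc r' + length sets * suc r' ≤⟨ +-monoʳ-≤ (suc r') few ⟩
      suc r' + (∣ rest ∣ + r')       ≡⟨ +-assoc (suc r') ∣ rest ∣ r' ⟨
      (suc r' + ∣ rest ∣) + r'       ≡⟨ cong (λ z → z + ∣ rest ∣ + r') size-part ⟨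
      (∣ part ∣ + ∣ rest ∣) + r'     ≡⟨ cong (_+ r') size-sum ⟩
      ∣ X ∣ + r'                     ∎ }
  where
  open Split S
  open Cover C
  open ≤-Reasoning
  part-meets : Meets part X
  part-meets with nonempty⇒member part (subst (1 ≤_) (sym size-part) (s≤s z≤n))
  ... | u , part-u = witness-meets part X u part-u (part⊆X u part-u)
  meets-X : ∀ {ρ} → ∣ ρ ∣ ≡ suc r' × Meets ρ rest → ∣ ρ ∣ ≡ suc r' × Meets ρ X
  meets-X {ρ} (∣ρ∣ , ρ-meets) with meets-witness ρ rest ρ-meets
  ... | u , ρu , rest-u = ∣ρ∣ , witness-meets ρ X u ρu (rest⊆X u rest-u)

cover : ∀ {k} r' (X : Subset k) → suc r' ≤ k → Cover r' X
cover r' X suc-r'≤k = go ∣ X ∣ X ≤-refl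
  where
  go : ∀ f X → ∣ X ∣ ≤ f → Cover r' X
  go f X ∣X∣≤f with ∣ X ∣ ≤? suc r'
  ... | yes ∣X∣≤r = cover-small r' X ∣X∣≤r suc-r'≤k
  go zero    X ∣X∣≤0 | no ∣X∣≰r = ⊥-elim (∣X∣≰r (≤-trans ∣X∣≤0 z≤n))
  go (suc f) X ∣X∣≤f | no ∣X∣≰r = cover-step r' X S (go f (Split.rest S) rest≤f)
    where
    S = split (suc r') X (<⇒≤ (≰⇒> ∣X∣≰r))
    open Split S
    rest≤f : ∣ rest ∣ ≤ f
    rest≤f = ≤-pred (begin
      suc ∣ rest ∣          ≤⟨ +-monoˡ-≤ ∣ rest ∣ (s≤s z≤n) ⟩
      suc r' + ∣ rest ∣     ≡⟨ cong (_+ ∣ rest ∣) size-part ⟨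
      ∣ part ∣ + ∣ rest ∣   ≡⟨ size-sum ⟩
      ∣ X ∣                 ≤⟨ ∣X∣≤f ⟩
      suc f                 ∎)
      where open ≤-Reasoning

max-below : ∀ {A : Set} (f : A → ℕ) b → 0 < b → (∀ x → f x < b) → (xs : List A) → foldr _⊔_ 0 (map f xs) < b
max-below f b 0<b f<b []       = 0<b
max-below f b 0<b f<b (x ∷ xs) = ⊔-lub (f<b x) (max-below f b 0<b f<b xs)

ratio-gain : ∀ e e' t c Δ → 3 ≤ c → Δ < c → e ≤ e' + t → t * c < e → e * (2 ⊔ Δ) < e' * c
ratio-gain e e' t (suc c) Δ (s≤s 2≤c) (s≤s Δ≤c) e≤e'+t tc<e =
  ≤-trans (s≤s (*-monoʳ-≤ e (⊔-lub 2≤c Δ≤c))) (+-cancelˡ-< e (e * c) (e' * suc c) (begin-strict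
    e + e * c                 ≡⟨ *-suc e c ⟨
    e * suc c                 ≤⟨ *-monoˡ-≤ (suc c) e≤e'+t ⟩
    (e' + t) * suc c          ≡⟨ *-distribʳ-+ (suc c) e' t ⟩
    e' * suc c + t * suc c    <⟨ +-monoʳ-< (e' * suc c) tc<e ⟩
    e' * suc c + e            ≡⟨ +-comm (e' * suc c) e ⟩
    e + e' * suc c            ∎))
  where open ≤-Reasoning

cover-count≤ : ∀ t w r' → t * suc r' ≤ w + r' → t ≤ w
cover-count≤ t w r' tr≤w+r' = ≤-pred (*-cancelʳ-< (suc r') t (suc w) (begin-strict
  t * suc r'         ≤⟨ tr≤w+r' ⟩
  w + r'             ≡⟨ +-comm w r' ⟩
  r' + w             <⟨ s≤s (+-monoʳ-≤ r' (m≤m*n w (suc r'))) ⟩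
  suc w * suc r'     ∎))
  where open ≤-Reasoning

same-edges⇒≅ : ∀ {k r} (G H : Hypergraph k r) → (∀ s → isEdge G s ≡ isEdge H s) → G ≅ H
same-edges⇒≅ G H same = id , λ s → trans (same s) (cong (isEdge H) (sym (tabulate∘lookup s)))

through : ∀ {k} → ℕ → Fin k → Subset k → Bool
through r u s = (∣ s ∣ ≡ᵇ r) ∧ lookup s u

count-through : ∀ n r' (u : Fin (suc n)) → count (through (suc r') u) (allSubsets (suc n)) ≡ n C r'
count-through n r' u = begin
  count (through (suc r') u) (allSubsets (suc n))
    ≡⟨ count-ext (λ s → trans (sym (∧-identityʳ _)) (cong (through (suc r') u s ∧_) (sym (disjoint-∅ s)))) (allSubsets (suc n)) ⟩
  count (λ s → through (suc r') u s ∧ disjoint s ∅) (allSubsets (suc n))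
    ≡⟨ count-through-disjoint n r' u ∅ (lookup-∅ u) ⟩
  (n ∸ ∣ ∅ {suc n} ∣) C r'
    ≡⟨ cong (λ z → (n ∸ z) C r') (∣⊥∣≡0 (suc n)) ⟩
  n C r' ∎
  where open ≡-Reasoning

module Saturation (n r' : ℕ) (G : Hypergraph (suc n) (suc r')) where

  E : Subset (suc n) → Bool
  E = isEdge G

  L : List (Subset (suc n))
  L = allSubsets (suc n)

  Cn : ℕ
  Cn = n C r'

  edge-size : ∀ s → T (E s) → T (∣ s ∣ ≡ᵇ suc r')
  edge-size s Es = ≡⇒≡ᵇ _ _ (uniform G s Es)

  through-edge : ∀ u s → (through (suc r') u s ∧ E s) ≡ (E s ∧ lookup s u)
  through-edge u s with E s in Es
  ... | false = ∧-zeroʳ _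
  ... | true rewrite Equivalence.to T-≡ (edge-size s (Equivalence.from T-≡ Es)) = ∧-identityʳ _

  missing : Fin (suc n) → ℕ
  missing u = count (λ s → through (suc r') u s ∧ not (E s)) L

  through-split : ∀ u → Cn ≡ degree G u + missing u
  through-split u = begin
    Cn                                                     ≡⟨ count-through n r' u ⟨
    count (through (suc r') u) L                           ≡⟨ count-split (through (suc r') u) E L ⟩
    count (λ s → through (suc r') u s ∧ E s) L + missing u ≡⟨ cong (_+ missing u) (count-ext (through-edge u) L) ⟩
    degree G u + missing u                                 ∎
    where open ≡-Reasoning

  degree≤Cn : ∀ u → degree G u ≤ Cn
  degree≤Cn u = subst (degree G u ≤_) (sym (through-split u)) (m≤m+n _ _)

  saturated-complete : ∀ u → degree G u ≡ Cn → ∀ s → T (through (suc r') u s) → T (E s)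
  saturated-complete u saturated s su with E s in Es
  ... | true  = tt
  ... | false = ⊥-elim (1+n≰n (subst (1 ≤_) no-missing
                  (count-pos _ (∈-allSubsets s) (∧-introᵀ su (Equivalence.from T-not-≡ Es)))))
    where
    no-missing : missing u ≡ 0
    no-missing = +-cancelˡ-≡ (degree G u) _ _
      (trans (sym (through-split u)) (trans (sym saturated) (sym (+-identityʳ _))))

  W : Subset (suc n)
  W = tabulate (λ u → degree G u ≡ᵇ Cn)

  W-saturated : ∀ u → T (lookup W u) → degree G u ≡ Cn
  W-saturated u u∈W = ≡ᵇ⇒≡ _ _ (subst T (lookup∘tabulate (λ u → degree G u ≡ᵇ Cn) u) u∈W)

  outside-W : ∀ u → lookup W u ≡ false → degree G u < Cn
  outside-W u u∉W with m≤n⇒m<n∨m≡n (degree≤Cn u)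
  ... | inj₁ deg<Cn = deg<Cn
  ... | inj₂ deg≡Cn = ⊥-elim (subst T (trans (sym (lookup∘tabulate (λ u → degree G u ≡ᵇ Cn) u)) u∉W)
                                      (≡⇒≡ᵇ _ _ deg≡Cn))

  meets-W⇒edge : ∀ s → T (∣ s ∣ ≡ᵇ suc r') → Meets s W → T (E s)
  meets-W⇒edge s ∣s∣≡r meets with meets-witness s W meets
  ... | u , su , u∈W = saturated-complete u (W-saturated u u∈W) s (∧-introᵀ ∣s∣≡r su)

  non-edge : ¬ (G ≅ complete (suc n) (suc r')) → Σ (Subset (suc n)) λ N → T (∣ N ∣ ≡ᵇ suc r') × E N ≡ false
  non-edge ¬complete with anySubset? (λ s → T? ((∣ s ∣ ≡ᵇ suc r') ∧ not (E s)))
  ... | yes (N , N-missing) = N , ∧-elimˡᵀ N-missing , Equivalence.to T-not-≡ (∧-elimʳᵀ N-missing)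
  ... | no none = ⊥-elim (¬complete (same-edges⇒≅ G (complete (suc n) (suc r')) edges))
    where
    edges : ∀ s → E s ≡ (∣ s ∣ ≡ᵇ suc r')
    edges s with E s in Es
    ... | true  = sym (Equivalence.to T-≡ (edge-size s (Equivalence.from T-≡ Es)))
    ... | false = sym (¬T⇒false (λ ∣s∣≡r → none (s , ∧-introᵀ ∣s∣≡r (Equivalence.from T-not-≡ Es))))

  -- A non-edge avoids W, so the saturated vertices leave room for an r-set.
  room : ¬ (G ≅ complete (suc n) (suc r')) → ∣ W ∣ + suc r' ≤ suc n
  room ¬complete with non-edge ¬complete
  ... | N , ∣N∣≡r , EN≡false with disjoint N W in disjoint-N-W
  ...   | false = ⊥-elim (subst T EN≡false (meets-W⇒edge N ∣N∣≡r (Equivalence.from T-not-≡ disjoint-N-W)))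
  ...   | true  = subst (λ z → ∣ W ∣ + z ≤ suc n) (≡ᵇ⇒≡ _ _ ∣N∣≡r)
                    (subst (_≤ suc n) (+-comm ∣ N ∣ ∣ W ∣) (disjoint-size N W (Equivalence.from T-≡ disjoint-N-W)))

  -- If G is not the star at a saturated vertex v, some edge avoids v, so e > Cn.
  beyond-star : ∀ v → degree G v ≡ Cn → ¬ (G ≅ star (suc n) (suc r') v) → Cn < numEdges G
  beyond-star v saturated ¬star with anySubset? (λ s → T? (E s ∧ not (lookup s v)))
  ... | yes (s , avoids) = begin-strict
    Cn                                               ≡⟨ saturated ⟨
    degree G v                                       <⟨ m<m+n (degree G v) (count-pos _ (∈-allSubsets s) avoids) ⟩
    degree G v + count (λ s → E s ∧ not (lookup s v)) L ≡⟨ count-split E (λ s → lookup s v) L ⟨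
    numEdges G                                       ∎
    where open ≤-Reasoning
  ... | no none = ⊥-elim (¬star (same-edges⇒≅ G (star (suc n) (suc r') v) edges))
    where
    edges : ∀ s → E s ≡ ((∣ s ∣ ≡ᵇ suc r') ∧ lookup s v)
    edges s with E s in Es | lookup s v in sv
    ... | true  | true  = sym (trans (∧-identityʳ _) (Equivalence.to T-≡ (edge-size s (Equivalence.from T-≡ Es))))
    ... | true  | false = ⊥-elim (none (s , ∧-introᵀ (Equivalence.from T-≡ Es) (Equivalence.from T-not-≡ sv)))
    ... | false | false = sym (∧-zeroʳ _)
    ... | false | true  = sym (¬T⇒false (λ r-set → subst T Es
            (saturated-complete v saturated s (∧-introᵀ (∧-elimˡᵀ r-set) (Equivalence.from T-≡ sv)))))

  -- Outside W, the r-sets through u that meet W are all edges, and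
  -- C(n - |W|, r') of the Cn r-sets through u avoid W.
  degree-outside-W : ∀ u → lookup W u ≡ false → Cn ∸ (n ∸ ∣ W ∣) C r' ≤ degree G u
  degree-outside-W u u∉W = begin
    Cn ∸ D                             ≡⟨ cong (_∸ D) through-count ⟩
    (D + meeting) ∸ D                  ≡⟨ m+n∸m≡n D meeting ⟩
    meeting                            ≤⟨ count-mono meeting⇒edge L ⟩
    degree G u                         ∎
    where
    open ≤-Reasoning
    D = (n ∸ ∣ W ∣) C r'
    meeting = count (λ s → through (suc r') u s ∧ not (disjoint s W)) L
    through-count : Cn ≡ D + meeting
    through-count = trans (sym (count-through n r' u))
      (trans (count-split (through (suc r') u) (λ s → disjoint s W) L)
             (cong (_+ meeting) (count-through-disjoint n r' u W u∉W)))
    meeting⇒edge : ∀ s → T (through (suc r') u s ∧ not (disjoint s W)) → T (E s ∧ lookup s u)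
    meeting⇒edge s p = ∧-introᵀ (meets-W⇒edge s r-set meets) u∈s
      where
      through-u = ∧-elimˡᵀ {through (suc r') u s} p
      meets     = ∧-elimʳᵀ {through (suc r') u s} p
      r-set     = ∧-elimˡᵀ {∣ s ∣ ≡ᵇ suc r'} through-u
      u∈s       = ∧-elimʳᵀ {∣ s ∣ ≡ᵇ suc r'} through-u

  -- Summing degrees: saturated vertices contribute Cn, the others at least Cn - D.
  degree-sum : ∣ W ∣ * Cn + (suc n ∸ ∣ W ∣) * (Cn ∸ (n ∸ ∣ W ∣) C r') ≤ suc r' * numEdges G
  degree-sum = begin
    ∣ W ∣ * Cn + (suc n ∸ ∣ W ∣) * (Cn ∸ D)        ≡⟨ sum-two-valued W Cn (Cn ∸ D) ⟨
    sum (λ u → if lookup W u then Cn else Cn ∸ D)  ≤⟨ sum-mono lower ⟩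
    sum (degree G)                                 ≡⟨ handshake E (suc r') (uniform G) L ⟩
    suc r' * numEdges G                            ∎
    where
    open ≤-Reasoning
    D = (n ∸ ∣ W ∣) C r'
    lower : ∀ u → (if lookup W u then Cn else Cn ∸ D) ≤ degree G u
    lower u with lookup W u in Wu
    ... | true  = ≤-reflexive (sym (W-saturated u (Equivalence.from T-≡ Wu)))
    ... | false = degree-outside-W u Wu

  many-saturated : ∀ t → 1 ≤ r' → 2 ≤ ∣ W ∣ → ∣ W ∣ + suc r' ≤ suc n →
    t * suc r' ≤ ∣ W ∣ + r' → t * Cn < numEdges G
  many-saturated t 1≤r' 2≤w w+r≤k tr≤w+r' = *-cancelˡ-< (suc r') (t * Cn) (numEdges G) (begin-strict
    suc r' * (t * Cn)                ≡⟨ reorder (suc r') t Cn ⟩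
    (t * suc r') * Cn                ≤⟨ *-monoˡ-≤ Cn tr≤w+r' ⟩
    (w + r') * Cn                    ≡⟨ *-distribʳ-+ Cn w r' ⟩
    w * Cn + r' * Cn                 <⟨ +-monoʳ-< (w * Cn) spare ⟩
    w * Cn + suc a * (Cn ∸ D)        ≡⟨ cong (λ z → w * Cn + z * (Cn ∸ D)) (+-∸-assoc 1 w≤n) ⟨
    w * Cn + (suc n ∸ w) * (Cn ∸ D)  ≤⟨ degree-sum ⟩
    suc r' * numEdges G              ∎)
    where
    open ≤-Reasoning
    w = ∣ W ∣
    a = n ∸ w
    D = a C r'
    reorder : ∀ x y z → x * (y * z) ≡ (y * x) * z
    reorder = solve-∀
    w+r'≤n : w + r' ≤ n
    w+r'≤n = ≤-pred (subst (_≤ suc n) (+-suc w r') w+r≤k)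
    w≤n : w ≤ n
    w≤n = ≤-trans (m≤m+n w r') w+r'≤n
    r'≤a : r' ≤ a
    r'≤a = m+n≤o⇒m≤o∸n r' (subst (_≤ n) (+-comm w r') w+r'≤n)
    a+2≤n : a + 2 ≤ n
    a+2≤n = subst (a + 2 ≤_) (m∸n+n≡m w≤n) (+-monoʳ-≤ a 2≤w)
    spare : r' * Cn < suc a * (Cn ∸ D)
    spare = subst (r' * Cn <_) (sym (*-distribˡ-∸ (suc a) Cn D))
              (m+n≤o⇒m≤o∸n (suc (r' * Cn)) (binomial-key a r' n 1≤r' r'≤a a+2≤n))

-- Removing a small cover of the saturated vertices.  The cover sets are r-sets
-- meeting W, hence edges; deleting them lowers every saturated degree.
module Removal (n r' : ℕ) (G : Hypergraph (suc n) (suc r')) (r≤k : suc r' ≤ suc n) where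

  open Saturation n r' G
  open Cover (cover r' W r≤k)

  removed : Subset (suc n) → Bool
  removed = oneOf sets

  t : ℕ
  t = length sets

  G' : Hypergraph (suc n) (suc r')
  G' = record { isEdge = λ s → E s ∧ not (removed s) ; uniform = λ s e → uniform G s (∧-elimˡᵀ e) }

  G'⊆G : G' ⊆G G
  G'⊆G s e = ∧-elimˡᵀ e

  edges-lost : numEdges G ≤ numEdges G' + t
  edges-lost = begin
    numEdges G                                           ≡⟨ count-split E removed L ⟩
    count (λ s → E s ∧ removed s) L + numEdges G'        ≡⟨ +-comm _ (numEdges G') ⟩
    numEdges G' + count (λ s → E s ∧ removed s) L        ≤⟨ +-monoʳ-≤ (numEdges G') removed-count ⟩
    numEdges G' + t                                      ∎
    where
    open ≤-Reasoning
    removed-count : count (λ s → E s ∧ removed s) L ≤ t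
    removed-count = ≤-trans (count-mono (λ s → ∧-elimʳᵀ {E s}) L) (count-oneOf sets)

  degree-drop : ∀ u → degree G u ≡ count (λ s → (E s ∧ lookup s u) ∧ removed s) L + degree G' u
  degree-drop u = trans (count-split (λ s → E s ∧ lookup s u) removed L)
    (cong (count (λ s → (E s ∧ lookup s u) ∧ removed s) L +_) (count-ext swap L))
    where
    swap : ∀ s → ((E s ∧ lookup s u) ∧ not (removed s)) ≡ ((E s ∧ not (removed s)) ∧ lookup s u)
    swap s = begin
      (E s ∧ lookup s u) ∧ not (removed s)    ≡⟨ ∧-assoc (E s) _ _ ⟩
      E s ∧ (lookup s u ∧ not (removed s))    ≡⟨ cong (E s ∧_) (∧-comm (lookup s u) _) ⟩
      E s ∧ (not (removed s) ∧ lookup s u)    ≡⟨ ∧-assoc (E s) _ _ ⟨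
      (E s ∧ not (removed s)) ∧ lookup s u    ∎
      where open ≡-Reasoning

  -- Every degree of G' is below Cn: off W already in G, on W because a cover
  -- set through u is a removed edge.
  degree-G'<Cn : ∀ u → degree G' u < Cn
  degree-G'<Cn u with lookup W u in Wu
  ... | false = ≤-<-trans (subst (degree G' u ≤_) (sym (degree-drop u)) (m≤n+m _ _)) (outside-W u Wu)
  ... | true with pick sets valid (covers u (Equivalence.from T-≡ Wu))
  ...   | ρ , (∣ρ∣≡r , ρ-meets) , u∈ρ , ρ-removed = begin-strict
    degree G' u                        <⟨ m<n+m (degree G' u) lost ⟩
    lost-at-u + degree G' u            ≡⟨ degree-drop u ⟨
    degree G u                         ≡⟨ W-saturated u (Equivalence.from T-≡ Wu) ⟩
    Cn                                 ∎
    where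
    open ≤-Reasoning
    lost-at-u = count (λ s → (E s ∧ lookup s u) ∧ removed s) L
    ρ-edge : T (E ρ)
    ρ-edge = meets-W⇒edge ρ (≡⇒≡ᵇ _ _ ∣ρ∣≡r) ρ-meets
    lost : 0 < lost-at-u
    lost = count-pos _ (∈-allSubsets ρ) (∧-introᵀ (∧-introᵀ ρ-edge u∈ρ) ρ-removed)

  maxDegree-G'<Cn : 0 < Cn → maxDegree G' < Cn
  maxDegree-G'<Cn 0<Cn = max-below (degree G') Cn 0<Cn degree-G'<Cn (allFin (suc n))

  removed-few : 1 ≤ r' → 1 ≤ numEdges G → ¬ (G ≅ complete (suc n) (suc r')) →
    (∀ v → ¬ (G ≅ star (suc n) (suc r') v)) → t * Cn < numEdges G
  removed-few 1≤r' 1≤e ¬complete ¬star = by-size ∣ W ∣ refl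
    where
    t≤w : t ≤ ∣ W ∣
    t≤w = cover-count≤ t ∣ W ∣ r' few
    by-size : ∀ w → ∣ W ∣ ≡ w → t * Cn < numEdges G
    by-size zero          ∣W∣≡0 rewrite n≤0⇒n≡0 (subst (t ≤_) ∣W∣≡0 t≤w) = 1≤e
    by-size (suc zero)    ∣W∣≡1 with nonempty⇒member W (subst (1 ≤_) (sym ∣W∣≡1) ≤-refl)
    ... | v , v∈W = ≤-<-trans (subst (t * Cn ≤_) (*-identityˡ Cn) (*-monoˡ-≤ Cn (subst (t ≤_) ∣W∣≡1 t≤w)))
                              (beyond-star v (W-saturated v v∈W) (¬star v))
    by-size (suc (suc _)) ∣W∣≡2+ =
      many-saturated t 1≤r' (subst (2 ≤_) (sym ∣W∣≡2+) (s≤s (s≤s z≤n))) (room ¬complete) few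

corollary4p11 : (k r : ℕ) → 3 ≤ r → r < k → (G : Hypergraph k r) →
    1 ≤ numEdges G → ¬ (G ≅ complete k r) → (∀ (v : Fin k) → ¬ (G ≅ star k r v)) →
    Σ (Hypergraph k r) (λ G' → G' ⊆G G ×
    numEdges G * (2 ⊔ maxDegree G') < numEdges G' * ((k ∸ 1) C (r ∸ 1)))
corollary4p11 (suc n) (suc r') (s≤s 2≤r') (s≤s r'<n) G 1≤e ¬complete ¬star =
  G' , G'⊆G ,
  ratio-gain (numEdges G) (numEdges G') t (n C r') (maxDegree G') 3≤C
    (maxDegree-G'<Cn (≤-trans (s≤s z≤n) 3≤C)) edges-lost
    (removed-few (≤-trans (s≤s z≤n) 2≤r') 1≤e ¬complete ¬star)
  where
  open Removal n r' G (m≤n⇒m≤1+n r'<n)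
  3≤C : 3 ≤ n C r'
  3≤C = C≥3 n r' 2≤r' r'<n
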